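{- Let $C$ be a maximal configuration on the $m\times n$ grid, identified with its indicator matrix $C_{i,j}\in\{0,1\}$. Then for every $1<i<m$ and $2<j<n-1$: if $C_{i,j}=0$, then at least one of the following holds: (E) $C_{i,j+1}+C_{i,j+2}+C_{i+1,j+1}=3$; (W) $C_{i,j-1}+C_{i,j-2}+C_{i+1,j-1}=3$; (N) $C_{i-1,j+1}+C_{i-1,j-1}+C_{i-1,j}=3$; (C) $C_{i,j+1}+C_{i,j-1}+C_{i+1,j}=3$.
   Context: The $m\times n$ grid is $[m]\times[n]=\{(i,j):1\le i\le m,\ 1\le j\le n\}$; $(i,j)$ is the lot in row $i$ and column $j$, rows counted from the north (row $1$ northernmost, row $m$ southernmost) and columns from the west. A configuration is a subset $C\subseteq[m]\times[n]$ (the occupied lots), equivalently a $0$-$1$ matrix with $C_{i,j}=1$ iff $(i,j)$ is occupied. A house at $(i,j)\in C$ is blocked from sunlight if $(i,j+1)$, $(i,j-1)$, $(i+1,j)$ all lie in the grid and are all occupied (lots outside the grid never obstruct sunlight). A configuration is permissible if no house in it is blocked; it is maximal if it is permissible and no permissible configuration strictly contains it. -}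

module Defs where

open import Data.Nat using (ℕ; suc; _+_; _∸_; _≤_; _<_)
open import Data.Bool using (Bool; true; false)
open import Data.Product using (_×_; ∃₂)
open import Relation.Nullary using (¬_)
open import Relation.Binary.PropositionalEquality using (_≡_)

-- Lot (i , j): row i (1 = northernmost, m = southernmost), column j (1 = westernmost).
InGrid : ℕ → ℕ → ℕ → ℕ → Set
InGrid m n i j = (1 ≤ i × i ≤ m) × (1 ≤ j × j ≤ n)

record Config (m n : ℕ) : Set where
  field
    occ    : ℕ → ℕ → Bool
    inside : ∀ i j → occ i j ≡ true → InGrid m n i j
open Config public

Occupied : ∀ {m n} → Config m n → ℕ → ℕ → Set
Occupied C i j = occ C i j ≡ true

Obstructs : ∀ {m n} → Config m n → ℕ → ℕ → Set
Obstructs {m} {n} C i j = InGrid m n i j × Occupied C i j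

-- House at (i,j) is blocked: (i,j+1), (i,j-1), (i+1,j) all in the grid and occupied.
-- For j = 1, j ∸ 1 = 0 is outside the grid, so that condition fails as it should.
Blocked : ∀ {m n} → Config m n → ℕ → ℕ → Set
Blocked C i j = Obstructs C i (j + 1) × Obstructs C i (j ∸ 1) × Obstructs C (i + 1) j

Permissible : ∀ {m n} → Config m n → Set
Permissible C = ∀ i j → Occupied C i j → ¬ Blocked C i j

_⊆_ : ∀ {m n} → Config m n → Config m n → Set
C ⊆ D = ∀ i j → Occupied C i j → Occupied D i j

_⊂_ : ∀ {m n} → Config m n → Config m n → Set
C ⊂ D = C ⊆ D × ∃₂ (λ i j → Occupied D i j × ¬ Occupied C i j)

Maximal : ∀ {m n} → Config m n → Set
Maximal C = Permissible C × (∀ D → Permissible D → ¬ (C ⊂ D))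

entry : ∀ {m n} → Config m n → ℕ → ℕ → ℕ
entry C i j with occ C i j
... | true  = 1
... | false = 0

{-# OPTIONS --safe #-}
module Submission where

-- If C_{i,j} = 0, the new house at (i,j) can only spoil permissibility by being
-- blocked itself (pattern C), or by completing the blocking of the house east of it
-- (pattern E), west of it (pattern W) or north of it (pattern N). So if none of the
-- four patterns occurs, C ∪ {(i,j)} is a permissible proper extension of C,
-- contradicting maximality.

open import Defs
open import Data.Bool using (Bool; true; if_then_else_; _∧_)
open import Data.Nat using (ℕ; suc; _+_; _∸_; _<_; _≤_; s≤s; z≤n; _≟_)
open import Data.Nat.Properties
  using ( ≟-diag; 1+n≢0; m+1+n≢m; <⇒≢; <⇒≤; ≤-refl; ≤-trans; ≤-<-trans; m<m+n
        ; +-suc; m∸n≤m; m+n∸n≡m; m∸n+n≡m; ∸-+-assoc )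
open import Data.Product using (_×_; _,_; proj₁; proj₂)
open import Data.Sum using (_⊎_; inj₁; inj₂)
open import Function using (_∘_)
open import Relation.Nullary using (¬_; yes; no; contradiction)
open import Relation.Nullary.Decidable using (⌊_⌋; _⊎-dec_; decidable-stable)
open import Relation.Binary.PropositionalEquality
  using (_≡_; _≢_; refl; sym; trans; subst; cong)

n∸1≢n : ∀ {n} → 1 ≤ n → n ∸ 1 ≢ n
n∸1≢n {suc n} _ = <⇒≢ ≤-refl

n∸1≢n+1 : ∀ n → n ∸ 1 ≢ n + 1
n∸1≢n+1 n = <⇒≢ (≤-<-trans (m∸n≤m n 1) (m<m+n n (s≤s z≤n)))

n+1∸2≡n∸1 : ∀ n → n + 1 ∸ 2 ≡ n ∸ 1
n+1∸2≡n∸1 n = trans (sym (∸-+-assoc (n + 1) 1 1)) (cong (_∸ 1) (m+n∸n≡m n 1))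

n∸1+2≡n+1 : ∀ {n} → 1 ≤ n → n ∸ 1 + 2 ≡ n + 1
n∸1+2≡n+1 {suc n} _ = +-suc n 1

module _ {m n : ℕ} (C : Config m n) where

  Occupied³ : ℕ × ℕ → ℕ × ℕ → ℕ × ℕ → Set
  Occupied³ (a , b) (c , d) (e , f) = Occupied C a b × Occupied C c d × Occupied C e f

  entry-occupied : ∀ {a b} → Occupied C a b → entry C a b ≡ 1
  entry-occupied o rewrite o = refl

  entry≡0⇒unoccupied : ∀ {a b} → entry C a b ≡ 0 → ¬ Occupied C a b
  entry≡0⇒unoccupied e o = 1+n≢0 (trans (sym (entry-occupied o)) e)

  entry-sum≡3 : ∀ {a b c d e f} → Occupied³ (a , b) (c , d) (e , f) →
    entry C a b + entry C c d + entry C e f ≡ 3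
  entry-sum≡3 (o₁ , o₂ , o₃)
    rewrite entry-occupied o₁ | entry-occupied o₂ | entry-occupied o₃ = refl

  occ-insert : ℕ → ℕ → ℕ → ℕ → Bool
  occ-insert i j a b = if ⌊ a ≟ i ⌋ ∧ ⌊ b ≟ j ⌋ then true else occ C a b

  occ-insert⁻ : ∀ i j a b → occ-insert i j a b ≡ true → (a ≡ i × b ≡ j) ⊎ Occupied C a b
  occ-insert⁻ i j a b o with a ≟ i | b ≟ j
  ... | yes a≡i | yes b≡j = inj₁ (a≡i , b≡j)
  ... | yes _   | no _    = inj₂ o
  ... | no _    | _       = inj₂ o

  occ-insert⁺ : ∀ i j a b → Occupied C a b → occ-insert i j a b ≡ true
  occ-insert⁺ i j a b o with a ≟ i | b ≟ j
  ... | yes _ | yes _ = refl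
  ... | yes _ | no _  = o
  ... | no _  | _     = o

  occ-insert-self : ∀ i j → occ-insert i j i j ≡ true
  occ-insert-self i j rewrite ≟-diag (refl {x = i}) | ≟-diag (refl {x = j}) = refl

  occ-insert-row≢ : ∀ {i j a b} → a ≢ i → occ-insert i j a b ≡ true → Occupied C a b
  occ-insert-row≢ {i} {j} {a} {b} a≢i o with occ-insert⁻ i j a b o
  ... | inj₁ (a≡i , _) = contradiction a≡i a≢i
  ... | inj₂ o′ = o′

  occ-insert-col≢ : ∀ {i j a b} → b ≢ j → occ-insert i j a b ≡ true → Occupied C a b
  occ-insert-col≢ {i} {j} {a} {b} b≢j o with occ-insert⁻ i j a b o
  ... | inj₁ (_ , b≡j) = contradiction b≡j b≢j
  ... | inj₂ o′ = o′

  insert : ∀ {i j} → InGrid m n i j → Config m n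
  insert {i} {j} g = record { occ = occ-insert i j ; inside = inside-insert }
    where
    inside-insert : ∀ a b → occ-insert i j a b ≡ true → InGrid m n a b
    inside-insert a b o with occ-insert⁻ i j a b o
    ... | inj₁ (refl , refl) = g
    ... | inj₂ o′ = inside C a b o′

  ⊂-insert : ∀ {i j} (g : InGrid m n i j) → ¬ Occupied C i j → C ⊂ insert g
  ⊂-insert {i} {j} g free = occ-insert⁺ i j , i , j , occ-insert-self i j , free

  insert-permissible : ∀ {i j} (g : InGrid m n i j) → Permissible C →
    ¬ Occupied³ (i , j + 1) (i , j + 2) (i + 1 , j + 1) →
    ¬ Occupied³ (i , j ∸ 1) (i , j ∸ 2) (i + 1 , j ∸ 1) →
    ¬ Occupied³ (i ∸ 1 , j + 1) (i ∸ 1 , j ∸ 1) (i ∸ 1 , j) →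
    ¬ Occupied³ (i , j + 1) (i , j ∸ 1) (i + 1 , j) →
    Permissible (insert g)
  insert-permissible {i} {j} g P ¬E ¬W ¬N ¬C a b house
                     ((east∈ , east) , (west∈ , west) , (south∈ , south))
    with occ-insert⁻ i j a b house
  ... | inj₁ (refl , refl) =
    ¬C ( occ-insert-col≢ (m+1+n≢m b) east
       , occ-insert-col≢ (n∸1≢n (proj₁ (proj₂ g))) west
       , occ-insert-row≢ (m+1+n≢m a) south )
  ... | inj₂ houseC with occ-insert⁻ i j a (b + 1) east
  ...   | inj₁ (refl , refl) =
    ¬W ( subst (Occupied C a) (sym (m+n∸n≡m b 1)) houseC
       , subst (Occupied C a) (sym (n+1∸2≡n∸1 b)) (occ-insert-col≢ (n∸1≢n+1 b) west)
       , subst (Occupied C (a + 1)) (sym (m+n∸n≡m b 1)) (occ-insert-row≢ (m+1+n≢m a) south) )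
  ...   | inj₂ eastC with occ-insert⁻ i j a (b ∸ 1) west
  ...     | inj₁ (refl , refl) =
    ¬E ( subst (Occupied C a) (sym (m∸n+n≡m 1≤b)) houseC
       , subst (Occupied C a) (sym (n∸1+2≡n+1 1≤b)) eastC
       , subst (Occupied C (a + 1)) (sym (m∸n+n≡m 1≤b)) (occ-insert-row≢ (m+1+n≢m a) south) )
    where
    1≤b : 1 ≤ b
    1≤b = proj₁ (proj₂ (inside C a b houseC))
  ...     | inj₂ westC with occ-insert⁻ i j (a + 1) b south
  ...       | inj₁ (refl , refl) =
    ¬N (subst (λ r → Occupied³ (r , b + 1) (r , b ∸ 1) (r , b)) (sym (m+n∸n≡m a 1))
              (eastC , westC , houseC))
  ...       | inj₂ southC = P a b houseC ((east∈ , eastC) , (west∈ , westC) , (south∈ , southC))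

lemma5p3 : (m n : ℕ) (C : Config m n) → Maximal C →
    (i j : ℕ) → 1 < i → i < m → 2 < j → j < n ∸ 1 →
    entry C i j ≡ 0 →
    (entry C i (j + 1) + entry C i (j + 2) + entry C (i + 1) (j + 1) ≡ 3)
    ⊎ (entry C i (j ∸ 1) + entry C i (j ∸ 2) + entry C (i + 1) (j ∸ 1) ≡ 3)
    ⊎ (entry C (i ∸ 1) (j + 1) + entry C (i ∸ 1) (j ∸ 1) + entry C (i ∸ 1) j ≡ 3)
    ⊎ (entry C i (j + 1) + entry C i (j ∸ 1) + entry C (i + 1) j ≡ 3)
lemma5p3 m n C (P , maximal) i j 1<i i<m 2<j j<n∸1 Cᵢⱼ≡0 =
  decidable-stable (_ ≟ 3 ⊎-dec _ ≟ 3 ⊎-dec _ ≟ 3 ⊎-dec _ ≟ 3) λ none →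
    maximal (insert C g)
      (insert-permissible C g P
        (none ∘ inj₁ ∘ entry-sum≡3 C)
        (none ∘ inj₂ ∘ inj₁ ∘ entry-sum≡3 C)
        (none ∘ inj₂ ∘ inj₂ ∘ inj₁ ∘ entry-sum≡3 C)
        (none ∘ inj₂ ∘ inj₂ ∘ inj₂ ∘ entry-sum≡3 C))
      (⊂-insert C g (entry≡0⇒unoccupied C Cᵢⱼ≡0))
  where
  -- Only (i , j) ∈ grid is used.
  g : InGrid m n i j
  g = (<⇒≤ 1<i , <⇒≤ i<m) , (≤-trans (s≤s z≤n) (<⇒≤ 2<j) , ≤-trans (<⇒≤ j<n∸1) (m∸n≤m n 1))
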